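{- Let $0\le r<m$ be integers and $a$ a positive real number. If $\sum_{i=0}^{r}\binom{m}{i}a^i\ge\binom{m}{r+1}a^r$, then $\sum_{i=0}^{r}\binom{m-1}{i}a^i>\binom{m-1}{r+1}a^r$. -}

module Defs where

open import Level using (0ℓ)
open import Data.Nat using (ℕ; suc) renaming (zero to z)
open import Data.Product using (Σ; _×_; ∃)
open import Relation.Nullary using (¬_)
open import Relation.Binary.Core using (Rel)
open import Relation.Binary.Structures using (IsTotalOrder)
open import Algebra.Bundles using (CommutativeRing)

-- An axiomatisation of the real numbers: a Dedekind-complete ordered field.
-- (Classically every such structure is isomorphic to ℝ; quantifying over all
-- of them is how we state a theorem about real numbers.)
record RealField : Set₁ where
  field
    commutativeRing : CommutativeRing 0ℓ 0ℓ
  open CommutativeRing commutativeRing public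
  field
    _≤_          : Rel Carrier 0ℓ
    isTotalOrder : IsTotalOrder _≈_ _≤_
    0≉1          : ¬ (0# ≈ 1#)
    inverse      : ∀ x → ¬ (x ≈ 0#) → ∃ λ y → x * y ≈ 1#
    +-monoˡ-≤    : ∀ {x y} z → x ≤ y → (x + z) ≤ (y + z)
    *-nonneg     : ∀ {x y} → 0# ≤ x → 0# ≤ y → 0# ≤ (x * y)
    sup          : (P : Carrier → Set) → (∃ λ x → P x)
                 → (∃ λ b → ∀ x → P x → x ≤ b)
                 → ∃ λ s → (∀ x → P x → x ≤ s)
                             × (∀ b → (∀ x → P x → x ≤ b) → s ≤ b)

  infix 4 _<_
  _<_ : Rel Carrier 0ℓ
  x < y = (x ≤ y) × ¬ (x ≈ y)

  fromℕ : ℕ → Carrier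
  fromℕ z    = 0#
  fromℕ (suc n) = 1# + fromℕ n

  pow : Carrier → ℕ → Carrier
  pow x z    = 1#
  pow x (suc n) = x * pow x n

  sumTo : ℕ → (ℕ → Carrier) → Carrier
  sumTo z    f = f z
  sumTo (suc r) f = sumTo r f + f (suc r)

{-# OPTIONS --safe #-}
-- Write n = m - 1, c i = n C i and S = Σ_{i<r} c i a^i. Pascal's rule turns the
-- hypothesis into c (r+1) a^r ≤ (1 + a) S. Call i steep when (1 + a) c i ≤ a c (i+1).
-- Since c (i+1) / c i = (n - i) / (i + 1) decreases in i, steepness at r would force
-- steepness at every i ≤ r, hence a S < c r a^r by geometric growth of the terms,
-- which contradicts the hypothesis. So a c (r+1) < (1 + a) c r, and adding a^r times
-- this to the hypothesis gives (1 + a) c (r+1) a^r < (1 + a) (S + c r a^r).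
module Submission where

open import Defs
open import Data.Nat using (ℕ; suc; _∸_)
open import Data.Nat.Combinatorics using (_C_; nCk+nC[k+1]≡[n+1]C[k+1]; nC1≡n)
import Data.Nat as N
import Data.Nat.Properties as NP
open import Relation.Binary.PropositionalEquality as P using (_≡_)
open import Data.Product using (_,_; proj₁)
open import Data.Sum using (inj₁; inj₂)
open import Level using (0ℓ)
open import Relation.Nullary using (¬_)
open import Relation.Binary.Core using (Rel)
open import Relation.Binary.Bundles using (TotalOrder)
open import Relation.Binary.Structures using (IsTotalOrder)
import Relation.Binary.Properties.TotalOrder as TotalOrderProperties
import Relation.Binary.Reasoning.PartialOrder as PartialOrderReasoning
import Algebra.Properties.Ring as RingProperties
import Algebra.Properties.Group as GroupProperties
import Algebra.Solver.Ring.NaturalCoefficients.Default as NaturalCoefficientsSolver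

module _ where
  open import Data.Nat using (zero; _+_; _*_; _≤_; _<_; z≤n; s≤s)
  open import Data.Nat.Properties using (≤-trans; m≤m+n; *-zeroʳ; *-identityʳ; +-identityʳ)
  open import Data.Nat.Solver using (module +-*-Solver)
  open import Relation.Binary.PropositionalEquality using (refl; sym; trans; cong₂; module ≡-Reasoning)

  0<nCk : ∀ {n k} → k ≤ n → 0 < n C k
  0<nCk {k = zero} _ = s≤s z≤n
  0<nCk {suc n} {suc k} (s≤s k≤n) rewrite sym (nCk+nC[k+1]≡[n+1]C[k+1] n k) =
    ≤-trans (0<nCk k≤n) (m≤m+n (n C k) (n C suc k))

  [k+1]*nC[k+1]+k*nCk≡n*nCk : ∀ n k → suc k * (n C suc k) + k * (n C k) ≡ n * (n C k)
  [k+1]*nC[k+1]+k*nCk≡n*nCk zero    zero    = refl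
  [k+1]*nC[k+1]+k*nCk≡n*nCk zero    (suc k) rewrite *-zeroʳ (suc k) = refl
  [k+1]*nC[k+1]+k*nCk≡n*nCk (suc n) zero    rewrite nC1≡n (suc n) =
    trans (+-identityʳ _) (trans (+-identityʳ _) (sym (*-identityʳ (suc n))))
  [k+1]*nC[k+1]+k*nCk≡n*nCk (suc n) (suc k)
    rewrite sym (nCk+nC[k+1]≡[n+1]C[k+1] n (suc k))
          | sym (nCk+nC[k+1]≡[n+1]C[k+1] n k) = begin
      suc (suc k) * (c₁ + c₂) + suc k * (c₀ + c₁)
        ≡⟨ regroup k c₀ c₁ c₂ ⟩
      (suc (suc k) * c₂ + suc k * c₁) + (c₁ + c₀ + (suc k * c₁ + k * c₀))
        ≡⟨ cong₂ (λ x y → x + (c₁ + c₀ + y))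
             ([k+1]*nC[k+1]+k*nCk≡n*nCk n (suc k)) ([k+1]*nC[k+1]+k*nCk≡n*nCk n k) ⟩
      n * c₁ + (c₁ + c₀ + n * c₀)
        ≡⟨ collect n c₀ c₁ ⟩
      suc n * (c₀ + c₁)
        ∎
    where
    open ≡-Reasoning
    open +-*-Solver
    c₀ = n C k
    c₁ = n C suc k
    c₂ = n C suc (suc k)
    regroup : ∀ k c₀ c₁ c₂ → suc (suc k) * (c₁ + c₂) + suc k * (c₀ + c₁) ≡
      (suc (suc k) * c₂ + suc k * c₁) + (c₁ + c₀ + (suc k * c₁ + k * c₀))
    regroup = solve 4 (λ k c₀ c₁ c₂ →
      (con 2 :+ k) :* (c₁ :+ c₂) :+ (con 1 :+ k) :* (c₀ :+ c₁) :=
      ((con 2 :+ k) :* c₂ :+ (con 1 :+ k) :* c₁) :+ (c₁ :+ c₀ :+ ((con 1 :+ k) :* c₁ :+ k :* c₀))) refl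
    collect : ∀ n c₀ c₁ → n * c₁ + (c₁ + c₀ + n * c₀) ≡ suc n * (c₀ + c₁)
    collect = solve 3 (λ n c₀ c₁ →
      n :* c₁ :+ (c₁ :+ c₀ :+ n :* c₀) := (con 1 :+ n) :* (c₀ :+ c₁)) refl

module OrderedFieldProperties (R : RealField) where
  open RealField R hiding (_≤_)

  -- RealField._≤_ has no fixity declaration; this synonym parses as usual.
  infix 4 _≤_
  _≤_ : Rel Carrier 0ℓ
  _≤_ = RealField._≤_ R

  totalOrder : TotalOrder 0ℓ 0ℓ 0ℓ
  totalOrder = record { isTotalOrder = isTotalOrder }

  open IsTotalOrder isTotalOrder using (total; antisym) renaming (reflexive to ≤-reflexive)
  open TotalOrderProperties totalOrder public using (≰⇒>)
  open PartialOrderReasoning (TotalOrder.poset totalOrder) public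
  open RingProperties ring using (-1*x≈-x; -‿involutive)
  open GroupProperties +-group using (//-rightDividesˡ; //-rightDividesʳ)

  +-monoʳ-≤ : ∀ z {x y} → x ≤ y → z + x ≤ z + y
  +-monoʳ-≤ z {x} {y} x≤y = begin
    z + x  ≈⟨ +-comm z x ⟩
    x + z  ≤⟨ +-monoˡ-≤ z x≤y ⟩
    y + z  ≈⟨ +-comm y z ⟩
    z + y  ∎

  +-mono-≤ : ∀ {x y u v} → x ≤ y → u ≤ v → x + u ≤ y + v
  +-mono-≤ {x} {y} {u} {v} x≤y u≤v = begin
    x + u  ≤⟨ +-monoˡ-≤ u x≤y ⟩
    y + u  ≤⟨ +-monoʳ-≤ y u≤v ⟩
    y + v  ∎

  +-cancelʳ-≤ : ∀ z {x y} → x + z ≤ y + z → x ≤ y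
  +-cancelʳ-≤ z {x} {y} le = begin
    x            ≈⟨ //-rightDividesʳ z x ⟨
    x + z + - z  ≤⟨ +-monoˡ-≤ (- z) le ⟩
    y + z + - z  ≈⟨ //-rightDividesʳ z y ⟩
    y            ∎

  +-cancelˡ-≤ : ∀ z {x y} → z + x ≤ z + y → x ≤ y
  +-cancelˡ-≤ z {x} {y} le = +-cancelʳ-≤ z (begin
    x + z  ≈⟨ +-comm x z ⟩
    z + x  ≤⟨ le ⟩
    z + y  ≈⟨ +-comm z y ⟩
    y + z  ∎)

  +-monoˡ-< : ∀ z {x y} → x < y → x + z < y + z
  +-monoˡ-< z (x≤y , x≉y) =
    +-monoˡ-≤ z x≤y , λ eq → x≉y (antisym x≤y (+-cancelʳ-≤ z (≤-reflexive (sym eq))))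

  +-monoʳ-< : ∀ z {x y} → x < y → z + x < z + y
  +-monoʳ-< z {x} {y} x<y = begin-strict
    z + x  ≈⟨ +-comm z x ⟩
    x + z  <⟨ +-monoˡ-< z x<y ⟩
    y + z  ≈⟨ +-comm y z ⟩
    z + y  ∎

  x≤y⇒0≤y-x : ∀ {x y} → x ≤ y → 0# ≤ y + - x
  x≤y⇒0≤y-x {x} {y} x≤y = begin
    0#      ≈⟨ -‿inverseʳ x ⟨
    x + - x ≤⟨ +-monoˡ-≤ (- x) x≤y ⟩
    y + - x ∎

  -- Were 1# ≤ 0#, then 0# ≤ - 1# and so 0# ≤ (- 1#) * (- 1#) ≈ 1#.
  0≤1 : 0# ≤ 1#
  0≤1 with total 0# 1#
  ... | inj₁ 0≤1 = 0≤1
  ... | inj₂ 1≤0 = begin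
    0#              ≤⟨ *-nonneg 0≤-1 0≤-1 ⟩
    - 1# * - 1#     ≈⟨ -1*x≈-x (- 1#) ⟩
    - (- 1#)        ≈⟨ -‿involutive 1# ⟩
    1#              ∎
    where
    0≤-1 : 0# ≤ - 1#
    0≤-1 = begin
      0#          ≤⟨ x≤y⇒0≤y-x 1≤0 ⟩
      0# + - 1#   ≈⟨ +-identityˡ (- 1#) ⟩
      - 1#        ∎

  0<1 : 0# < 1#
  0<1 = 0≤1 , 0≉1

  0<1+x : ∀ {x} → 0# ≤ x → 0# < 1# + x
  0<1+x {x} 0≤x = begin-strict
    0#       <⟨ 0<1 ⟩
    1#       ≈⟨ +-identityʳ 1# ⟨
    1# + 0#  ≤⟨ +-monoʳ-≤ 1# 0≤x ⟩
    1# + x   ∎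

  *-monoʳ-≤-nonNeg : ∀ {p x y} → 0# ≤ p → x ≤ y → p * x ≤ p * y
  *-monoʳ-≤-nonNeg {p} {x} {y} 0≤p x≤y = begin
    p * x                  ≈⟨ +-identityˡ (p * x) ⟨
    0# + p * x             ≤⟨ +-monoˡ-≤ (p * x) (*-nonneg 0≤p (x≤y⇒0≤y-x x≤y)) ⟩
    p * (y + - x) + p * x  ≈⟨ distribˡ p (y + - x) x ⟨
    p * (y + - x + x)      ≈⟨ *-congˡ (//-rightDividesˡ x y) ⟩
    p * y                  ∎

  *-monoˡ-≤-nonNeg : ∀ {p x y} → 0# ≤ p → x ≤ y → x * p ≤ y * p
  *-monoˡ-≤-nonNeg {p} {x} {y} 0≤p x≤y = begin
    x * p  ≈⟨ *-comm x p ⟩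
    p * x  ≤⟨ *-monoʳ-≤-nonNeg 0≤p x≤y ⟩
    p * y  ≈⟨ *-comm p y ⟩
    y * p  ∎

  *-cancelˡ-≈-nonZero : ∀ {p x y} → ¬ (p ≈ 0#) → p * x ≈ p * y → x ≈ y
  *-cancelˡ-≈-nonZero {p} {x} {y} p≉0 eq with inverse p p≉0
  ... | q , pq≈1 = begin-equality
    x            ≈⟨ cancel x ⟩
    q * (p * x)  ≈⟨ *-congˡ eq ⟩
    q * (p * y)  ≈⟨ cancel y ⟨
    y            ∎
    where
    cancel : ∀ z → z ≈ q * (p * z)
    cancel z = begin-equality
      z             ≈⟨ *-identityˡ z ⟨
      1# * z        ≈⟨ *-congʳ pq≈1 ⟨
      p * q * z     ≈⟨ *-congʳ (*-comm p q) ⟩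
      q * p * z     ≈⟨ *-assoc q p z ⟩
      q * (p * z)   ∎

  *-monoʳ-<-pos : ∀ {p x y} → 0# < p → x < y → p * x < p * y
  *-monoʳ-<-pos (0≤p , 0≉p) (x≤y , x≉y) =
    *-monoʳ-≤-nonNeg 0≤p x≤y , λ eq → x≉y (*-cancelˡ-≈-nonZero (λ p≈0 → 0≉p (sym p≈0)) eq)

  *-monoˡ-<-pos : ∀ {p x y} → 0# < p → x < y → x * p < y * p
  *-monoˡ-<-pos {p} {x} {y} 0<p x<y = begin-strict
    x * p  ≈⟨ *-comm x p ⟩
    p * x  <⟨ *-monoʳ-<-pos 0<p x<y ⟩
    p * y  ≈⟨ *-comm p y ⟩
    y * p  ∎

  *-cancelˡ-≤-pos : ∀ {p x y} → 0# < p → p * x ≤ p * y → x ≤ y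
  *-cancelˡ-≤-pos {p} {x} {y} (0≤p , 0≉p) px≤py with total x y
  ... | inj₁ x≤y = x≤y
  ... | inj₂ y≤x = ≤-reflexive (*-cancelˡ-≈-nonZero (λ p≈0 → 0≉p (sym p≈0))
                               (antisym px≤py (*-monoʳ-≤-nonNeg 0≤p y≤x)))

  *-cancelˡ-<-pos : ∀ {p x y} → 0# < p → p * x < p * y → x < y
  *-cancelˡ-<-pos 0<p (px≤py , px≉py) = *-cancelˡ-≤-pos 0<p px≤py , λ x≈y → px≉py (*-congˡ x≈y)

  *-pos : ∀ {x y} → 0# < x → 0# < y → 0# < x * y
  *-pos {x} {y} 0<x 0<y = begin-strict
    0#      ≈⟨ zeroʳ x ⟨
    x * 0#  <⟨ *-monoʳ-<-pos 0<x 0<y ⟩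
    x * y   ∎

  pow-pos : ∀ {a} k → 0# < a → 0# < pow a k
  pow-pos N.zero    0<a = 0<1
  pow-pos (suc k)   0<a = *-pos 0<a (pow-pos k 0<a)

  fromℕ-+ : ∀ m n → fromℕ (m N.+ n) ≈ fromℕ m + fromℕ n
  fromℕ-+ N.zero  n = sym (+-identityˡ (fromℕ n))
  fromℕ-+ (suc m) n = begin-equality
    1# + fromℕ (m N.+ n)        ≈⟨ +-congˡ (fromℕ-+ m n) ⟩
    1# + (fromℕ m + fromℕ n)    ≈⟨ +-assoc 1# (fromℕ m) (fromℕ n) ⟨
    1# + fromℕ m + fromℕ n      ∎

  fromℕ-* : ∀ m n → fromℕ (m N.* n) ≈ fromℕ m * fromℕ n
  fromℕ-* N.zero  n = sym (zeroˡ (fromℕ n))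
  fromℕ-* (suc m) n = begin-equality
    fromℕ (n N.+ m N.* n)               ≈⟨ fromℕ-+ n (m N.* n) ⟩
    fromℕ n + fromℕ (m N.* n)           ≈⟨ +-cong (sym (*-identityˡ (fromℕ n))) (fromℕ-* m n) ⟩
    1# * fromℕ n + fromℕ m * fromℕ n    ≈⟨ distribʳ (fromℕ n) 1# (fromℕ m) ⟨
    (1# + fromℕ m) * fromℕ n            ∎

  fromℕ-nonNeg : ∀ n → 0# ≤ fromℕ n
  fromℕ-nonNeg N.zero    = ≤-reflexive refl
  fromℕ-nonNeg (suc n)   = proj₁ (0<1+x (fromℕ-nonNeg n))

  fromℕ-pos : ∀ {n} → 0 N.< n → 0# < fromℕ n
  fromℕ-pos {suc n} _ = 0<1+x (fromℕ-nonNeg n)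

  fromℕ-mono-≤ : ∀ {m n} → m N.≤ n → fromℕ m ≤ fromℕ n
  fromℕ-mono-≤ {n = n} N.z≤n = fromℕ-nonNeg n
  fromℕ-mono-≤ (N.s≤s m≤n)   = +-monoʳ-≤ 1# (fromℕ-mono-≤ m≤n)

module _ (R : RealField) where
  open RealField R hiding (_≤_)
  open OrderedFieldProperties R

  module BinomialSums (n : ℕ) {a : Carrier} (0<a : 0# < a) where
    open NaturalCoefficientsSolver commutativeSemiring using (solve; _:+_; _:*_; _:=_; con)

    0≤a : 0# ≤ a
    0≤a = proj₁ 0<a

    0<1+a : 0# < 1# + a
    0<1+a = 0<1+x 0≤a

    c : ℕ → Carrier
    c i = fromℕ (n C i)

    sumBelow : ℕ → Carrier
    sumBelow N.zero  = 0#
    sumBelow (suc k) = sumBelow k + c k * pow a k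

    -- Equivalently c (suc i) * pow a (suc i) is at least 1 + a times c i * pow a i.
    Steep : ℕ → Set
    Steep i = (1# + a) * c i ≤ a * c (suc i)

    -- Steep i restated via c (suc i) / c i = (n - i) / (i + 1).
    IndexBound : ℕ → Set
    IndexBound i = (1# + a) * fromℕ (suc i) + a * fromℕ i ≤ a * fromℕ n

    [i+1]c[i+1]+ic[i]≈nc[i] : ∀ i → fromℕ (suc i) * c (suc i) + fromℕ i * c i ≈ fromℕ n * c i
    [i+1]c[i+1]+ic[i]≈nc[i] i = begin-equality
      fromℕ (suc i) * c (suc i) + fromℕ i * c i
        ≈⟨ +-cong (fromℕ-* (suc i) (n C suc i)) (fromℕ-* i (n C i)) ⟨
      fromℕ (suc i N.* (n C suc i)) + fromℕ (i N.* (n C i))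
        ≈⟨ fromℕ-+ (suc i N.* (n C suc i)) (i N.* (n C i)) ⟨
      fromℕ (suc i N.* (n C suc i) N.+ i N.* (n C i))
        ≡⟨ P.cong fromℕ ([k+1]*nC[k+1]+k*nCk≡n*nCk n i) ⟩
      fromℕ (n N.* (n C i))
        ≈⟨ fromℕ-* n (n C i) ⟩
      fromℕ n * c i
        ∎

    private
      spread : ∀ x y s t → y * ((1# + x) * s + x * t) ≈ s * ((1# + x) * y) + x * (t * y)
      spread = solve 4 (λ x y s t →
        y :* ((con 1 :+ x) :* s :+ x :* t) := s :* ((con 1 :+ x) :* y) :+ x :* (t :* y)) refl

      factor : ∀ x y z s t → s * (x * y) + x * (t * z) ≈ x * (s * y + t * z)
      factor = solve 5 (λ x y z s t → s :* (x :* y) :+ x :* (t :* z) := x :* (s :* y :+ t :* z)) refl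

      swap : ∀ x y z → x * (z * y) ≈ y * (x * z)
      swap = solve 3 (λ x y z → x :* (z :* y) := y :* (x :* z)) refl

    steep⇒indexBound : ∀ {i} → i N.≤ n → Steep i → IndexBound i
    steep⇒indexBound {i} i≤n steep = *-cancelˡ-≤-pos (fromℕ-pos (0<nCk i≤n)) (begin
      c i * ((1# + a) * s + a * t)
        ≈⟨ spread a (c i) s t ⟩
      s * ((1# + a) * c i) + a * (t * c i)
        ≤⟨ +-monoˡ-≤ (a * (t * c i)) (*-monoʳ-≤-nonNeg (fromℕ-nonNeg (suc i)) steep) ⟩
      s * (a * c (suc i)) + a * (t * c i)
        ≈⟨ factor a (c (suc i)) (c i) s t ⟩
      a * (s * c (suc i) + t * c i)
        ≈⟨ *-congˡ ([i+1]c[i+1]+ic[i]≈nc[i] i) ⟩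
      a * (fromℕ n * c i)
        ≈⟨ swap a (c i) (fromℕ n) ⟩
      c i * (a * fromℕ n) ∎)
      where
      s = fromℕ (suc i)
      t = fromℕ i

    indexBound⇒steep : ∀ {i} → IndexBound i → Steep i
    indexBound⇒steep {i} bound =
      *-cancelˡ-≤-pos (fromℕ-pos {suc i} (N.s≤s N.z≤n)) (+-cancelʳ-≤ (a * (t * c i)) (begin
      s * ((1# + a) * c i) + a * (t * c i)
        ≈⟨ spread a (c i) s t ⟨
      c i * ((1# + a) * s + a * t)
        ≤⟨ *-monoʳ-≤-nonNeg (fromℕ-nonNeg (n C i)) bound ⟩
      c i * (a * fromℕ n)
        ≈⟨ swap a (c i) (fromℕ n) ⟨
      a * (fromℕ n * c i)
        ≈⟨ *-congˡ ([i+1]c[i+1]+ic[i]≈nc[i] i) ⟨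
      a * (s * c (suc i) + t * c i)
        ≈⟨ factor a (c (suc i)) (c i) s t ⟨
      s * (a * c (suc i)) + a * (t * c i) ∎))
      where
      s = fromℕ (suc i)
      t = fromℕ i

    indexBound-antitone : ∀ {i j} → j N.≤ i → IndexBound i → IndexBound j
    indexBound-antitone {i} {j} j≤i bound = begin
      (1# + a) * fromℕ (suc j) + a * fromℕ j
        ≤⟨ +-mono-≤ (*-monoʳ-≤-nonNeg (proj₁ 0<1+a) (fromℕ-mono-≤ (N.s≤s j≤i)))
                      (*-monoʳ-≤-nonNeg 0≤a (fromℕ-mono-≤ j≤i)) ⟩
      (1# + a) * fromℕ (suc i) + a * fromℕ i
        ≤⟨ bound ⟩
      a * fromℕ n ∎

    steep-downward : ∀ {i j} → i N.≤ n → Steep i → j N.≤ i → Steep j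
    steep-downward i≤n steep j≤i = indexBound⇒steep (indexBound-antitone j≤i (steep⇒indexBound i≤n steep))

    a*sumBelow<term : ∀ k → (∀ {i} → i N.< k → Steep i) → a * sumBelow k < c k * pow a k
    a*sumBelow<term N.zero    _     = begin-strict
      a * 0#
        ≈⟨ zeroʳ a ⟩
      0#
        <⟨ 0<1 ⟩
      1#
        ≈⟨ trans (*-identityʳ (1# + 0#)) (+-identityʳ 1#) ⟨
      (1# + 0#) * 1# ∎
    a*sumBelow<term (suc k) steep = begin-strict
      a * (sumBelow k + c k * pow a k)
        ≈⟨ distribˡ a (sumBelow k) (c k * pow a k) ⟩
      a * sumBelow k + a * (c k * pow a k)
        <⟨ +-monoˡ-< (a * (c k * pow a k)) (a*sumBelow<term k (λ i<k → steep (NP.m<n⇒m<1+n i<k))) ⟩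
      c k * pow a k + a * (c k * pow a k)
        ≈⟨ solve 3 (λ a c p → c :* p :+ a :* (c :* p) := (con 1 :+ a) :* c :* p) refl a (c k) (pow a k) ⟩
      (1# + a) * c k * pow a k
        ≤⟨ *-monoˡ-≤-nonNeg (proj₁ (pow-pos k 0<a)) (steep (NP.n<1+n k)) ⟩
      a * c (suc k) * pow a k
        ≈⟨ solve 3 (λ a c p → a :* c :* p := c :* (a :* p)) refl a (c (suc k)) (pow a k) ⟩
      c (suc k) * (a * pow a k) ∎

    sumTo≈sumBelow : ∀ r → sumTo r (λ i → c i * pow a i) ≈ sumBelow (suc r)
    sumTo≈sumBelow N.zero  = sym (+-identityˡ (c 0 * pow a 0))
    sumTo≈sumBelow (suc r) = +-congʳ (sumTo≈sumBelow r)

    fromℕ-pascal : ∀ i → fromℕ (suc n C suc i) ≈ c i + c (suc i)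
    fromℕ-pascal i = begin-equality
      fromℕ (suc n C suc i)
        ≡⟨ P.cong fromℕ (nCk+nC[k+1]≡[n+1]C[k+1] n i) ⟨
      fromℕ (n C i N.+ n C suc i)
        ≈⟨ fromℕ-+ (n C i) (n C suc i) ⟩
      c i + c (suc i) ∎

    sumTo-pascal : ∀ r → sumTo r (λ i → fromℕ (suc n C i) * pow a i) ≈ sumBelow (suc r) + a * sumBelow r
    sumTo-pascal N.zero = begin-equality
      c 0 * 1#
        ≈⟨ +-identityˡ (c 0 * 1#) ⟨
      0# + c 0 * 1#
        ≈⟨ +-identityʳ (0# + c 0 * 1#) ⟨
      0# + c 0 * 1# + 0#
        ≈⟨ +-congˡ (zeroʳ a) ⟨
      0# + c 0 * 1# + a * 0# ∎
    sumTo-pascal (suc r) = begin-equality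
      sumTo r (λ i → fromℕ (suc n C i) * pow a i) + fromℕ (suc n C suc r) * pow a (suc r)
        ≈⟨ +-cong (sumTo-pascal r) (*-congʳ (fromℕ-pascal r)) ⟩
      sumBelow (suc r) + a * sumBelow r + (c r + c (suc r)) * (a * pow a r)
        ≈⟨ solve 5 (λ s x y a p → s :+ x :* p :+ a :* s :+ (x :+ y) :* (a :* p)
                                 := s :+ x :* p :+ y :* (a :* p) :+ a :* (s :+ x :* p))
                   refl (sumBelow r) (c r) (c (suc r)) a (pow a r) ⟩
      sumBelow (suc (suc r)) + a * sumBelow (suc r) ∎

    term≤[1+a]*sumBelow : ∀ r →
      fromℕ (suc n C suc r) * pow a r ≤ sumTo r (λ i → fromℕ (suc n C i) * pow a i) →
      c (suc r) * pow a r ≤ (1# + a) * sumBelow r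
    term≤[1+a]*sumBelow r hyp = +-cancelˡ-≤ (c r * pow a r) (begin
      c r * pow a r + c (suc r) * pow a r
        ≈⟨ distribʳ (pow a r) (c r) (c (suc r)) ⟨
      (c r + c (suc r)) * pow a r
        ≈⟨ *-congʳ (fromℕ-pascal r) ⟨
      fromℕ (suc n C suc r) * pow a r
        ≤⟨ hyp ⟩
      sumTo r (λ i → fromℕ (suc n C i) * pow a i)
        ≈⟨ sumTo-pascal r ⟩
      sumBelow r + c r * pow a r + a * sumBelow r
        ≈⟨ solve 4 (λ s x p a → s :+ x :* p :+ a :* s := x :* p :+ (con 1 :+ a) :* s)
                   refl (sumBelow r) (c r) (pow a r) a ⟩
      c r * pow a r + (1# + a) * sumBelow r ∎)

    module _ {r} (r≤n : r N.≤ n) (term≤ : c (suc r) * pow a r ≤ (1# + a) * sumBelow r) where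

      ¬steep : ¬ Steep r
      ¬steep steep = begin-contradiction
        (1# + a) * (a * sumBelow r)
          <⟨ *-monoʳ-<-pos 0<1+a (a*sumBelow<term r (λ i<r → steep-downward r≤n steep (NP.<⇒≤ i<r))) ⟩
        (1# + a) * (c r * pow a r)
          ≈⟨ *-assoc (1# + a) (c r) (pow a r) ⟨
        (1# + a) * c r * pow a r
          ≤⟨ *-monoˡ-≤-nonNeg (proj₁ (pow-pos r 0<a)) steep ⟩
        a * c (suc r) * pow a r
          ≈⟨ *-assoc a (c (suc r)) (pow a r) ⟩
        a * (c (suc r) * pow a r)
          ≤⟨ *-monoʳ-≤-nonNeg 0≤a term≤ ⟩
        a * ((1# + a) * sumBelow r)
          ≈⟨ solve 2 (λ a s → a :* ((con 1 :+ a) :* s) := (con 1 :+ a) :* (a :* s)) refl a (sumBelow r) ⟩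
        (1# + a) * (a * sumBelow r) ∎

      term<sumBelow : c (suc r) * pow a r < sumBelow (suc r)
      term<sumBelow = *-cancelˡ-<-pos 0<1+a (begin-strict
        (1# + a) * (c (suc r) * pow a r)
          ≈⟨ solve 3 (λ a y p → (con 1 :+ a) :* (y :* p) := y :* p :+ a :* y :* p)
                       refl a (c (suc r)) (pow a r) ⟩
        c (suc r) * pow a r + a * c (suc r) * pow a r
          ≤⟨ +-monoˡ-≤ (a * c (suc r) * pow a r) term≤ ⟩
        (1# + a) * sumBelow r + a * c (suc r) * pow a r
          <⟨ +-monoʳ-< ((1# + a) * sumBelow r) (*-monoˡ-<-pos (pow-pos r 0<a) (≰⇒> ¬steep)) ⟩
        (1# + a) * sumBelow r + (1# + a) * c r * pow a r
          ≈⟨ solve 4 (λ a s x p → (con 1 :+ a) :* s :+ (con 1 :+ a) :* x :* p := (con 1 :+ a) :* (s :+ x :* p))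
                       refl a (sumBelow r) (c r) (pow a r) ⟩
        (1# + a) * sumBelow (suc r) ∎)

lemma3p6 : (R : RealField) → let open RealField R in
    (r m : ℕ) → r N.< m → (a : Carrier) → 0# < a →
    (fromℕ (m C suc r) * pow a r) ≤ sumTo r (λ i → fromℕ (m C i) * pow a i) →
    fromℕ ((m ∸ 1) C suc r) * pow a r < sumTo r (λ i → fromℕ ((m ∸ 1) C i) * pow a i)
lemma3p6 R r (suc n) (N.s≤s r≤n) a 0<a hyp = begin-strict
  c (suc r) * pow a r            <⟨ term<sumBelow r≤n (term≤[1+a]*sumBelow r hyp) ⟩
  sumBelow (suc r)               ≈⟨ sumTo≈sumBelow r ⟨
  sumTo r (λ i → c i * pow a i)  ∎
  where
  open RealField R using (_*_; pow; sumTo)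
  open OrderedFieldProperties R
  open BinomialSums R n 0<a
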